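{- Let $F(x,y)$ be a polynomial of total degree $2$ with complex coefficients that maps $\mathbf{N}_0^2$ bijectively onto $\mathbf{N}_0$. Then there exist nonnegative integers $a,c,f$ and integers $b,d,e$ such that $a \equiv d \pmod 2$, $c \equiv e \pmod 2$, and \[ F(x,y) = \frac{1}{2}(ax^2 + 2bxy + cy^2) + \frac{1}{2}(dx + ey) + f. \] Moreover, if $a = c = 0$, then $b \geq 1$.
   Context: $\mathbf{N}_0 = \{0,1,2,\ldots\}$; $\mathbf{N}_0^2$ is the set of lattice points with nonnegative integer coordinates. -}

module Defs where

open import Level using (Level; _⊔_)
open import Algebra.Bundles using (CommutativeRing)
open import Data.Nat using (ℕ; zero; suc)
open import Data.Integer using (ℤ; +_; -[1+_])
open import Data.Product using (_×_; ∃)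
open import Relation.Nullary using (¬_)
open import Relation.Binary.PropositionalEquality using (_≡_)

module _ {c ℓ : Level} (R : CommutativeRing c ℓ) where
  open CommutativeRing R

  ιℕ : ℕ → Carrier
  ιℕ zero    = 0#
  ιℕ (suc n) = 1# + ιℕ n

  ιℤ : ℤ → Carrier
  ιℤ (+ n)      = ιℕ n
  ιℤ -[1+ n ]   = - ιℕ (suc n)

  -- R is a field of characteristic zero (e.g. ℂ)
  IsField₀ : Set (c ⊔ ℓ)
  IsField₀ = (¬ (1# ≈ 0#))
           × (∀ x → ¬ (x ≈ 0#) → ∃ λ y → x * y ≈ 1#)
           × (∀ m n → ιℕ m ≈ ιℕ n → m ≡ n)

  record Poly2 : Set c where
    constructor poly2
    field
      A B C D E G : Carrier

  eval : Poly2 → Carrier → Carrier → Carrier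
  eval (poly2 A B C D E G) x y =
    A * (x * x) + B * (x * y) + C * (y * y) + D * x + E * y + G

  Degree2 : Poly2 → Set ℓ
  Degree2 (poly2 A B C D E G) = ¬ ((A ≈ 0#) × (B ≈ 0#) × (C ≈ 0#))

{-# OPTIONS --safe #-}
-- Finite differences of F at (0,0), (1,0), (2,0), (0,1), (1,1), (0,2) express 2A, B, 2C, 2D, 2E
-- and G through values of F, hence through natural numbers; this gives integrality and the two
-- parity relations. Writing each coefficient of 2F as a difference of natural numbers gives a
-- subtraction-free identity 2F + N = P on ℕ² with N, P quadratics over ℕ. Comparing growth
-- along the two axes and the diagonal yields a ≥ 0, c ≥ 0, and b ≥ 0 when a = c = 0; then
-- b ≠ 0 because F has degree 2.
module Submission where

open import Defs
open import Level using (Level)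
open import Algebra.Bundles using (CommutativeRing)

module NatQuadratic where
  open import Data.Nat
  open import Data.Nat.Properties
  open import Data.Nat.Solver using (module +-*-Solver)
  open +-*-Solver
  open import Relation.Binary.PropositionalEquality as ≡ using (_≡_)

  record Quadℕ : Set where
    constructor quad
    field a b c d e f : ℕ

  open Quadℕ public

  evalℕ : Quadℕ → ℕ → ℕ → ℕ
  evalℕ (quad a b c d e f) x y = a * (x * x) + b * (x * y) + c * (y * y) + d * x + e * y + f

  quadratic : ℕ → ℕ → ℕ → ℕ → ℕ
  quadratic a d f x = a * (x * x) + d * x + f

  private
    quadₑ : ∀ {n} → (a b c d e f x y : Polynomial n) → Polynomial n
    quadₑ a b c d e f x y = a :* (x :* x) :+ b :* (x :* y) :+ c :* (y :* y) :+ d :* x :+ e :* y :+ f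

  evalℕ-on-x-axis : ∀ q x → evalℕ q x 0 ≡ quadratic (a q) (d q) (f q) x
  evalℕ-on-x-axis (quad a b c d e f) x = solve 7
    (λ a b c d e f x → quadₑ a b c d e f x (con 0) := a :* (x :* x) :+ d :* x :+ f)
    ≡.refl a b c d e f x

  evalℕ-on-y-axis : ∀ q y → evalℕ q 0 y ≡ quadratic (c q) (e q) (f q) y
  evalℕ-on-y-axis (quad a b c d e f) y = solve 7
    (λ a b c d e f y → quadₑ a b c d e f (con 0) y := c :* (y :* y) :+ e :* y :+ f)
    ≡.refl a b c d e f y

  evalℕ-on-diagonal : ∀ q x → evalℕ q x x ≡ quadratic (a q + b q + c q) (d q + e q) (f q) x
  evalℕ-on-diagonal (quad a b c d e f) x = solve 7
    (λ a b c d e f x → quadₑ a b c d e f x x := (a :+ b :+ c) :* (x :* x) :+ (d :+ e) :* x :+ f)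
    ≡.refl a b c d e f x

  linear<square : ∀ s t → s * suc (s + t) + t < suc (s + t) * suc (s + t)
  linear<square s t = begin-strict
    s * x + t  <⟨ +-monoʳ-< (s * x) (s≤s (m≤n+m t s)) ⟩
    s * x + x  ≡⟨ +-comm (s * x) x ⟩
    suc s * x  ≤⟨ *-monoˡ-≤ x (s≤s (m≤m+n s t)) ⟩
    x * x      ∎
    where
    open ≤-Reasoning
    x : ℕ
    x = suc (s + t)

  leading-coefficient-≤ : ∀ {a d f a′ d′ f′} →
    (∀ x → quadratic a d f x ≤ quadratic a′ d′ f′ x) → a ≤ a′
  leading-coefficient-≤ {a} {d} {f} {a′} {d′} {f′} p≤q = ≮⇒≥ λ a′<a → <-irrefl ≡.refl (begin-strict
    quadratic a d f x           ≤⟨ p≤q x ⟩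
    a′ * xx + d′ * x + f′       ≡⟨ +-assoc (a′ * xx) _ _ ⟩
    a′ * xx + (d′ * x + f′)     <⟨ +-monoʳ-< (a′ * xx) (linear<square d′ f′) ⟩
    a′ * xx + xx                ≡⟨ +-comm (a′ * xx) xx ⟩
    suc a′ * xx                 ≤⟨ *-monoˡ-≤ xx a′<a ⟩
    a * xx                      ≤⟨ ≤-trans (m≤m+n (a * xx) (d * x)) (m≤m+n _ f) ⟩
    quadratic a d f x           ∎)
    where
    open ≤-Reasoning
    x xx : ℕ
    x = suc (d′ + f′)
    xx = x * x

  module _ {p q : Quadℕ} (p≤q : ∀ x y → evalℕ p x y ≤ evalℕ q x y) where

    x²-coefficient-≤ : a p ≤ a q
    x²-coefficient-≤ = leading-coefficient-≤ {d = d p} {f p} {d′ = d q} {f q} λ x →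
      ≡.subst₂ _≤_ (evalℕ-on-x-axis p x) (evalℕ-on-x-axis q x) (p≤q x 0)

    y²-coefficient-≤ : c p ≤ c q
    y²-coefficient-≤ = leading-coefficient-≤ {d = e p} {f p} {d′ = e q} {f q} λ y →
      ≡.subst₂ _≤_ (evalℕ-on-y-axis p y) (evalℕ-on-y-axis q y) (p≤q 0 y)

    diagonal-coefficient-≤ : a p + b p + c p ≤ a q + b q + c q
    diagonal-coefficient-≤ = leading-coefficient-≤ {d = d p + e p} {f p} {d′ = d q + e q} {f q} λ x →
      ≡.subst₂ _≤_ (evalℕ-on-diagonal p x) (evalℕ-on-diagonal q x) (p≤q x x)

module IntegerArithmetic where
  open import Data.Nat as ℕ using (ℕ)
  import Data.Nat.Properties as ℕ
  import Data.Nat.Divisibility as ℕ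
  open import Data.Integer
  open import Data.Integer.Properties
  open import Data.Integer.Divisibility using (_∣_; *-monoʳ-∣)
  open import Data.Integer.Solver using (module +-*-Solver)
  open +-*-Solver
  open import Relation.Binary.PropositionalEquality

  +[m∸n]≡+m-+n : ∀ {m n} → n ℕ.≤ m → + (m ℕ.∸ n) ≡ + m - + n
  +[m∸n]≡+m-+n {m} {n} n≤m = trans (sym (⊖-≥ n≤m)) (sym (m-n≡m⊖n m n))

  m<n⇒+1≤+n-+m : ∀ {m n} → m ℕ.< n → + 1 ≤ + n - + m
  m<n⇒+1≤+n-+m m<n = subst (+ 1 ≤_) (+[m∸n]≡+m-+n (ℕ.<⇒≤ m<n)) (+≤+ (ℕ.m<n⇒0<n∸m m<n))

  2∣2* : ∀ k → + 2 ∣ + 2 * k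
  2∣2* k = *-monoʳ-∣ (+ 2) {+ 1} {k} (ℕ.1∣ ∣ k ∣)

  -- a − d = 2 (v₂ − 3 v₁ + 2 v₀) for a = v₂ − 2 v₁ + v₀ and d = 4 v₁ − 3 v₀ − v₂.
  second-difference-parity : ∀ v₀ v₁ v₂ → 2 ℕ.* v₁ ℕ.≤ v₂ ℕ.+ v₀ →
    + 2 ∣ + ((v₂ ℕ.+ v₀) ℕ.∸ 2 ℕ.* v₁) - (+ (4 ℕ.* v₁) - + (3 ℕ.* v₀ ℕ.+ v₂))
  second-difference-parity v₀ v₁ v₂ le =
    subst (+ 2 ∣_) (sym (trans embed regroup)) (2∣2* (+ v₂ - + 3 * + v₁ + + 2 * + v₀))
    where
    embed : + ((v₂ ℕ.+ v₀) ℕ.∸ 2 ℕ.* v₁) - (+ (4 ℕ.* v₁) - + (3 ℕ.* v₀ ℕ.+ v₂))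
          ≡ (+ v₂ + + v₀ - + 2 * + v₁) - (+ 4 * + v₁ - (+ 3 * + v₀ + + v₂))
    embed = cong₂ _-_
      (trans (+[m∸n]≡+m-+n le) (cong₂ _-_ (pos-+ v₂ v₀) (pos-* 2 v₁)))
      (cong₂ _-_ (pos-* 4 v₁) (trans (pos-+ (3 ℕ.* v₀) v₂) (cong (_+ + v₂) (pos-* 3 v₀))))
    regroup : (+ v₂ + + v₀ - + 2 * + v₁) - (+ 4 * + v₁ - (+ 3 * + v₀ + + v₂))
            ≡ + 2 * (+ v₂ - + 3 * + v₁ + + 2 * + v₀)
    regroup = solve 3 (λ v₀ v₁ v₂ →
      (v₂ :+ v₀ :- con (+ 2) :* v₁) :- (con (+ 4) :* v₁ :- (con (+ 3) :* v₀ :+ v₂))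
        := con (+ 2) :* (v₂ :- con (+ 3) :* v₁ :+ con (+ 2) :* v₀)) refl (+ v₀) (+ v₁) (+ v₂)

module RingEmbedding {c ℓ : Level} (R : CommutativeRing c ℓ) where
  open CommutativeRing R
  open import Algebra.Properties.Semiring.Mult semiring using (_×_; ×-homo-+; ×1-homo-*)
  open import Algebra.Properties.Group +-group using (∙-cancelʳ)
  open import Algebra.Solver.Ring.NaturalCoefficients.Default commutativeSemiring
  open import Relation.Binary.Reasoning.Setoid setoid
  open import Data.Nat as ℕ using (ℕ; zero; suc)
  import Data.Nat.Properties as ℕ
  open import Data.Integer as ℤ using (+_; _⊖_)
  open import Data.Integer.Properties using (m-n≡m⊖n; [1+m]⊖[1+n]≡m⊖n)
  open import Relation.Binary.PropositionalEquality as ≡ using (_≡_; _≢_)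
  open import Relation.Nullary using (¬_)
  open import Data.Product using (_,_; proj₁; proj₂)
  open NatQuadratic using (Quadℕ; quad; evalℕ)

  ι : ℕ → Carrier
  ι = ιℕ R

  ι≡×1# : ∀ n → ι n ≡ n × 1#
  ι≡×1# zero    = ≡.refl
  ι≡×1# (suc n) = ≡.cong (_+_ 1#) (ι≡×1# n)

  ι-+ : ∀ m n → ι (m ℕ.+ n) ≈ ι m + ι n
  ι-+ m n rewrite ι≡×1# (m ℕ.+ n) | ι≡×1# m | ι≡×1# n = ×-homo-+ 1# m n

  ι-* : ∀ m n → ι (m ℕ.* n) ≈ ι m * ι n
  ι-* m n rewrite ι≡×1# (m ℕ.* n) | ι≡×1# m | ι≡×1# n = ×1-homo-* m n

  ιℤ[m⊖n]+ιn≈ιm : ∀ m n → ιℤ R (m ⊖ n) + ι n ≈ ι m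
  ιℤ[m⊖n]+ιn≈ιm zero    zero    = +-identityʳ _
  ιℤ[m⊖n]+ιn≈ιm zero    (suc n) = -‿inverseˡ _
  ιℤ[m⊖n]+ιn≈ιm (suc m) zero    = +-identityʳ _
  ιℤ[m⊖n]+ιn≈ιm (suc m) (suc n) = begin
    ιℤ R (suc m ⊖ suc n) + (1# + ι n) ≡⟨ ≡.cong (λ i → ιℤ R i + (1# + ι n)) ([1+m]⊖[1+n]≡m⊖n m n) ⟩
    ιℤ R (m ⊖ n) + (1# + ι n)         ≈⟨ x+[1+y]≈1+[x+y] (ιℤ R (m ⊖ n)) (ι n) ⟩
    1# + (ιℤ R (m ⊖ n) + ι n)         ≈⟨ +-congˡ (ιℤ[m⊖n]+ιn≈ιm m n) ⟩
    1# + ι m                          ∎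
    where
    x+[1+y]≈1+[x+y] : ∀ x y → x + (1# + y) ≈ 1# + (x + y)
    x+[1+y]≈1+[x+y] = solve 2 (λ x y → x :+ (con 1 :+ y) := con 1 :+ (x :+ y)) refl

  +ι≈ι⇒≈ιℤ : ∀ {X} m n → X + ι n ≈ ι m → X ≈ ιℤ R (+ m ℤ.- + n)
  +ι≈ι⇒≈ιℤ {X} m n X+n≈m = ≡.subst (λ i → X ≈ ιℤ R i) (≡.sym (m-n≡m⊖n m n))
    (∙-cancelʳ (ι n) X (ιℤ R (m ⊖ n)) (trans X+n≈m (sym (ιℤ[m⊖n]+ιn≈ιm m n))))

  +ι≈ι⇒≈ι∸ : ∀ {X m n} → n ℕ.≤ m → X + ι n ≈ ι m → X ≈ ι (m ℕ.∸ n)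
  +ι≈ι⇒≈ι∸ {X} {m} {n} n≤m X+n≈m = ∙-cancelʳ (ι n) X (ι (m ℕ.∸ n)) (begin
    X + ι n             ≈⟨ X+n≈m ⟩
    ι m                 ≡⟨ ≡.cong ι (≡.sym (ℕ.m∸n+n≡m n≤m)) ⟩
    ι (m ℕ.∸ n ℕ.+ n)   ≈⟨ ι-+ (m ℕ.∸ n) n ⟩
    ι (m ℕ.∸ n) + ι n   ∎)

  +ι≈ι-scale : ∀ {X} k m n → X + ι m ≈ ι n → ι k * X + ι (k ℕ.* m) ≈ ι (k ℕ.* n)
  +ι≈ι-scale {X} k m n X+m≈n = begin
    ι k * X + ι (k ℕ.* m)   ≈⟨ +-congˡ (ι-* k m) ⟩
    ι k * X + ι k * ι m     ≈⟨ sym (distribˡ (ι k) X (ι m)) ⟩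
    ι k * (X + ι m)         ≈⟨ *-congˡ X+m≈n ⟩
    ι k * ι n               ≈⟨ sym (ι-* k n) ⟩
    ι (k ℕ.* n)             ∎

  ιPoly2 : Quadℕ → Poly2 R
  ιPoly2 (quad a b c d e f) = poly2 (ι a) (ι b) (ι c) (ι d) (ι e) (ι f)

  ι-evalℕ : ∀ q x y → ι (evalℕ q x y) ≈ eval R (ιPoly2 q) (ι x) (ι y)
  ι-evalℕ (quad a b c d e f) x y =
    ι-+-cong s₅ f (ι-+-cong s₄ (e ℕ.* y) (ι-+-cong s₃ (d ℕ.* x) (ι-+-cong s₂ (c ℕ.* (y ℕ.* y))
      (ι-+-cong s₁ (b ℕ.* (x ℕ.* y)) (ι-monomial a x x) (ι-monomial b x y))
      (ι-monomial c y y)) (ι-* d x)) (ι-* e y)) refl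
    where
    ι-+-cong : ∀ m n {u v} → ι m ≈ u → ι n ≈ v → ι (m ℕ.+ n) ≈ u + v
    ι-+-cong m n m≈u n≈v = trans (ι-+ m n) (+-cong m≈u n≈v)
    ι-monomial : ∀ k x y → ι (k ℕ.* (x ℕ.* y)) ≈ ι k * (ι x * ι y)
    ι-monomial k x y = trans (ι-* k (x ℕ.* y)) (*-congˡ (ι-* x y))
    s₁ s₂ s₃ s₄ s₅ : ℕ
    s₁ = a ℕ.* (x ℕ.* x)
    s₂ = s₁ ℕ.+ b ℕ.* (x ℕ.* y)
    s₃ = s₂ ℕ.+ c ℕ.* (y ℕ.* y)
    s₄ = s₃ ℕ.+ d ℕ.* x
    s₅ = s₄ ℕ.+ e ℕ.* y

  private
    evalₑ : ∀ {n} → (A B C D E G x y : Polynomial n) → Polynomial n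
    evalₑ A B C D E G x y = A :* (x :* x) :+ B :* (x :* y) :+ C :* (y :* y) :+ D :* x :+ E :* y :+ G

    -- Unlike con n, this unfolds to exactly ι n, so solve can match goals stated with ι.
    numeral : ∀ {n} → ℕ → Polynomial n
    numeral zero    = con 0
    numeral (suc m) = con 1 :+ numeral m

  eval-affine : ∀ k {A B C D E G A′ B′ C′ D′ E′ G′ A″ B″ C″ D″ E″ G″} →
    k * A + A′ ≈ A″ → k * B + B′ ≈ B″ → k * C + C′ ≈ C″ →
    k * D + D′ ≈ D″ → k * E + E′ ≈ E″ → k * G + G′ ≈ G″ → ∀ X Y →
    k * eval R (poly2 A B C D E G) X Y + eval R (poly2 A′ B′ C′ D′ E′ G′) X Y
      ≈ eval R (poly2 A″ B″ C″ D″ E″ G″) X Y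
  eval-affine k {A} {B} {C} {D} {E} {G} {A′} {B′} {C′} {D′} {E′} {G′} hA hB hC hD hE hG X Y =
    trans (regroup k A B C D E G A′ B′ C′ D′ E′ G′ X Y)
      (+-cong (+-cong (+-cong (+-cong (+-cong (*-congʳ hA) (*-congʳ hB)) (*-congʳ hC)) (*-congʳ hD)) (*-congʳ hE)) hG)
    where
    regroup : ∀ k A B C D E G A′ B′ C′ D′ E′ G′ X Y →
      k * eval R (poly2 A B C D E G) X Y + eval R (poly2 A′ B′ C′ D′ E′ G′) X Y
        ≈ eval R (poly2 (k * A + A′) (k * B + B′) (k * C + C′) (k * D + D′) (k * E + E′) (k * G + G′)) X Y
    regroup = solve 15 (λ k A B C D E G A′ B′ C′ D′ E′ G′ X Y →
      k :* evalₑ A B C D E G X Y :+ evalₑ A′ B′ C′ D′ E′ G′ X Y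
        := evalₑ (k :* A :+ A′) (k :* B :+ B′) (k :* C :+ C′) (k :* D :+ D′) (k :* E :+ E′) (k :* G :+ G′) X Y)
      refl

  module FiniteDifferences (A B C D E G : Carrier) where
    v : ℕ → ℕ → Carrier
    v x y = eval R (poly2 A B C D E G) (ι x) (ι y)

    second-difference-x : ι 2 * A + ι 2 * v 1 0 ≈ v 2 0 + v 0 0
    second-difference-x = solve 6 (λ A B C D E G →
      numeral 2 :* A :+ numeral 2 :* evalₑ A B C D E G (numeral 1) (numeral 0)
        := evalₑ A B C D E G (numeral 2) (numeral 0) :+ evalₑ A B C D E G (numeral 0) (numeral 0))
      refl A B C D E G

    second-difference-y : ι 2 * C + ι 2 * v 0 1 ≈ v 0 2 + v 0 0
    second-difference-y = solve 6 (λ A B C D E G →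
      numeral 2 :* C :+ numeral 2 :* evalₑ A B C D E G (numeral 0) (numeral 1)
        := evalₑ A B C D E G (numeral 0) (numeral 2) :+ evalₑ A B C D E G (numeral 0) (numeral 0))
      refl A B C D E G

    mixed-difference : B + (v 1 0 + v 0 1) ≈ v 1 1 + v 0 0
    mixed-difference = solve 6 (λ A B C D E G →
      B :+ (evalₑ A B C D E G (numeral 1) (numeral 0) :+ evalₑ A B C D E G (numeral 0) (numeral 1))
        := evalₑ A B C D E G (numeral 1) (numeral 1) :+ evalₑ A B C D E G (numeral 0) (numeral 0))
      refl A B C D E G

    first-difference-x : ι 2 * D + (ι 3 * v 0 0 + v 2 0) ≈ ι 4 * v 1 0
    first-difference-x = solve 6 (λ A B C D E G →
      numeral 2 :* D :+ (numeral 3 :* evalₑ A B C D E G (numeral 0) (numeral 0) :+ evalₑ A B C D E G (numeral 2) (numeral 0))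
        := numeral 4 :* evalₑ A B C D E G (numeral 1) (numeral 0))
      refl A B C D E G

    first-difference-y : ι 2 * E + (ι 3 * v 0 0 + v 0 2) ≈ ι 4 * v 0 1
    first-difference-y = solve 6 (λ A B C D E G →
      numeral 2 :* E :+ (numeral 3 :* evalₑ A B C D E G (numeral 0) (numeral 0) :+ evalₑ A B C D E G (numeral 0) (numeral 2))
        := numeral 4 :* evalₑ A B C D E G (numeral 0) (numeral 1))
      refl A B C D E G

    value-at-origin : v 0 0 ≈ G
    value-at-origin = solve 6 (λ A B C D E G → evalₑ A B C D E G (numeral 0) (numeral 0) := G) refl A B C D E G

  module _ (fld : IsField₀ R) where

    ι-injective : ∀ m n → ι m ≈ ι n → m ≡ n
    ι-injective = proj₂ (proj₂ fld)

    ι2*≈0⇒≈0 : ∀ {X} → ι 2 * X ≈ 0# → X ≈ 0#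
    ι2*≈0⇒≈0 {X} 2X≈0 = begin
      X                   ≈⟨ sym (*-identityˡ X) ⟩
      1# * X              ≈⟨ *-congʳ (sym 2y≈1) ⟩
      (ι 2 * y) * X       ≈⟨ *-assoc (ι 2) y X ⟩
      ι 2 * (y * X)       ≈⟨ *-congˡ (*-comm y X) ⟩
      ι 2 * (X * y)       ≈⟨ sym (*-assoc (ι 2) X y) ⟩
      (ι 2 * X) * y       ≈⟨ *-congʳ 2X≈0 ⟩
      0# * y              ≈⟨ zeroˡ y ⟩
      0#                  ∎
      where
      2≉0 : ¬ (ι 2 ≈ 0#)
      2≉0 2≈0 with ι-injective 2 0 2≈0
      ... | ()
      y : Carrier
      y = proj₁ (proj₁ (proj₂ fld) (ι 2) 2≉0)
      2y≈1 : ι 2 * y ≈ 1#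
      2y≈1 = proj₂ (proj₁ (proj₂ fld) (ι 2) 2≉0)

    module Coefficients (A B C D E G : Carrier) (g : ℕ → ℕ → ℕ)
      (hg : ∀ x y → eval R (poly2 A B C D E G) (ι x) (ι y) ≈ ι (g x y)) where
      open FiniteDifferences A B C D E G
      open NatQuadratic using (x²-coefficient-≤; y²-coefficient-≤; diagonal-coefficient-≤)

      hg-+ : ∀ x y x′ y′ → v x y + v x′ y′ ≈ ι (g x y ℕ.+ g x′ y′)
      hg-+ x y x′ y′ = trans (+-cong (hg x y) (hg x′ y′)) (sym (ι-+ (g x y) (g x′ y′)))

      hg-* : ∀ k x y → ι k * v x y ≈ ι (k ℕ.* g x y)
      hg-* k x y = trans (*-congˡ (hg x y)) (sym (ι-* k (g x y)))

      a⁺ a⁻ b⁺ b⁻ c⁺ c⁻ d⁺ d⁻ e⁺ e⁻ : ℕ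
      a⁺ = g 2 0 ℕ.+ g 0 0
      a⁻ = 2 ℕ.* g 1 0
      b⁺ = g 1 1 ℕ.+ g 0 0
      b⁻ = g 1 0 ℕ.+ g 0 1
      c⁺ = g 0 2 ℕ.+ g 0 0
      c⁻ = 2 ℕ.* g 0 1
      d⁺ = 4 ℕ.* g 1 0
      d⁻ = 3 ℕ.* g 0 0 ℕ.+ g 2 0
      e⁺ = 4 ℕ.* g 0 1
      e⁻ = 3 ℕ.* g 0 0 ℕ.+ g 0 2

      x²-relation : ι 2 * A + ι a⁻ ≈ ι a⁺
      x²-relation = trans (+-congˡ (sym (hg-* 2 1 0))) (trans second-difference-x (hg-+ 2 0 0 0))

      xy-relation : B + ι b⁻ ≈ ι b⁺
      xy-relation = trans (+-congˡ (sym (hg-+ 1 0 0 1))) (trans mixed-difference (hg-+ 1 1 0 0))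

      y²-relation : ι 2 * C + ι c⁻ ≈ ι c⁺
      y²-relation = trans (+-congˡ (sym (hg-* 2 0 1))) (trans second-difference-y (hg-+ 0 2 0 0))

      x-relation : ι 2 * D + ι d⁻ ≈ ι d⁺
      x-relation = trans (+-congˡ (trans (ι-+ (3 ℕ.* g 0 0) (g 2 0)) (+-cong (sym (hg-* 3 0 0)) (sym (hg 2 0)))))
        (trans first-difference-x (hg-* 4 1 0))

      y-relation : ι 2 * E + ι e⁻ ≈ ι e⁺
      y-relation = trans (+-congˡ (trans (ι-+ (3 ℕ.* g 0 0) (g 0 2)) (+-cong (sym (hg-* 3 0 0)) (sym (hg 0 2)))))
        (trans first-difference-y (hg-* 4 0 1))

      constant-relation : G ≈ ι (g 0 0)
      constant-relation = trans (sym value-at-origin) (hg 0 0)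

      -- 2F has coefficients a⁺ − a⁻, 2 (b⁺ − b⁻), c⁺ − c⁻, d⁺ − d⁻, e⁺ − e⁻, 2 g(0,0).
      negative-part positive-part : Quadℕ
      negative-part = quad a⁻ (2 ℕ.* b⁻) c⁻ d⁻ e⁻ 0
      positive-part = quad a⁺ (2 ℕ.* b⁺) c⁺ d⁺ e⁺ (2 ℕ.* g 0 0)

      2g+negative≡positive : ∀ x y → 2 ℕ.* g x y ℕ.+ evalℕ negative-part x y ≡ evalℕ positive-part x y
      2g+negative≡positive x y = ι-injective _ _ (begin
        ι (2 ℕ.* g x y ℕ.+ evalℕ negative-part x y)   ≈⟨ ι-+ (2 ℕ.* g x y) (evalℕ negative-part x y) ⟩
        ι (2 ℕ.* g x y) + ι (evalℕ negative-part x y)  ≈⟨ +-cong (sym (hg-* 2 x y)) (ι-evalℕ negative-part x y) ⟩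
        ι 2 * v x y + eval R (ιPoly2 negative-part) (ι x) (ι y)
          ≈⟨ eval-affine (ι 2) x²-relation (+ι≈ι-scale 2 b⁻ b⁺ xy-relation) y²-relation x-relation y-relation
               (+ι≈ι-scale 2 0 (g 0 0) (trans (+-identityʳ G) constant-relation)) (ι x) (ι y) ⟩
        eval R (ιPoly2 positive-part) (ι x) (ι y)      ≈⟨ sym (ι-evalℕ positive-part x y) ⟩
        ι (evalℕ positive-part x y)                    ∎)

      negative≤positive : ∀ x y → evalℕ negative-part x y ℕ.≤ evalℕ positive-part x y
      negative≤positive x y =
        ≡.subst (evalℕ negative-part x y ℕ.≤_) (2g+negative≡positive x y) (ℕ.m≤n+m _ (2 ℕ.* g x y))

      a⁻≤a⁺ : a⁻ ℕ.≤ a⁺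
      a⁻≤a⁺ = x²-coefficient-≤ {negative-part} {positive-part} negative≤positive

      c⁻≤c⁺ : c⁻ ℕ.≤ c⁺
      c⁻≤c⁺ = y²-coefficient-≤ {negative-part} {positive-part} negative≤positive

      b⁻<b⁺ : Degree2 R (poly2 A B C D E G) → a⁺ ℕ.∸ a⁻ ≡ 0 → c⁺ ℕ.∸ c⁻ ≡ 0 → b⁻ ℕ.< b⁺
      b⁻<b⁺ deg a≡0 c≡0 = ℕ.≤∧≢⇒< b⁻≤b⁺ b⁻≢b⁺
        where
        a⁺≡a⁻ : a⁺ ≡ a⁻
        a⁺≡a⁻ = ℕ.≤-antisym (ℕ.m∸n≡0⇒m≤n a≡0) a⁻≤a⁺
        c⁺≡c⁻ : c⁺ ≡ c⁻
        c⁺≡c⁻ = ℕ.≤-antisym (ℕ.m∸n≡0⇒m≤n c≡0) c⁻≤c⁺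
        b⁻≤b⁺ : b⁻ ℕ.≤ b⁺
        b⁻≤b⁺ = ℕ.*-cancelˡ-≤ 2 (ℕ.+-cancelˡ-≤ a⁻ _ _ (ℕ.+-cancelʳ-≤ c⁻ _ _
          (≡.subst₂ (λ a c → a⁻ ℕ.+ 2 ℕ.* b⁻ ℕ.+ c⁻ ℕ.≤ a ℕ.+ 2 ℕ.* b⁺ ℕ.+ c) a⁺≡a⁻ c⁺≡c⁻
            (diagonal-coefficient-≤ {negative-part} {positive-part} negative≤positive))))
        b⁻≢b⁺ : b⁻ ≢ b⁺
        b⁻≢b⁺ b⁻≡b⁺ = deg (A≈0 , B≈0 , C≈0)
          where
          A≈0 : A ≈ 0#
          A≈0 = ι2*≈0⇒≈0 (trans (+ι≈ι⇒≈ι∸ a⁻≤a⁺ x²-relation) (reflexive (≡.cong ι a≡0)))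
          C≈0 : C ≈ 0#
          C≈0 = ι2*≈0⇒≈0 (trans (+ι≈ι⇒≈ι∸ c⁻≤c⁺ y²-relation) (reflexive (≡.cong ι c≡0)))
          B≈0 : B ≈ 0#
          B≈0 = ∙-cancelʳ (ι b⁻) B 0#
            (trans xy-relation (trans (reflexive (≡.cong ι (≡.sym b⁻≡b⁺))) (sym (+-identityˡ (ι b⁻)))))

open import Data.Nat using (ℕ; _∸_)
open import Data.Integer using (ℤ; +_; _-_; _≤_)
open import Data.Integer.Divisibility using (_∣_)
open import Data.Product using (_×_; Σ-syntax; uncurry; _,_)
open import Function.Definitions using (Bijective)
open import Relation.Binary.PropositionalEquality using (_≡_)
open IntegerArithmetic using (second-difference-parity; m<n⇒+1≤+n-+m)

lemma3 : {c ℓ : Level} (R : CommutativeRing c ℓ) → IsField₀ R →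
  let open CommutativeRing R hiding (_-_) in
  (F : Poly2 R) → Degree2 R F →
  (g : ℕ → ℕ → ℕ) →
  (∀ x y → eval R F (ιℕ R x) (ιℕ R y) ≈ ιℕ R (g x y)) →
  Bijective _≡_ _≡_ (uncurry g) →
  Σ[ a ∈ ℕ ] Σ[ c′ ∈ ℕ ] Σ[ f ∈ ℕ ] Σ[ b ∈ ℤ ] Σ[ d ∈ ℤ ] Σ[ e ∈ ℤ ]
    ((+ 2) ∣ (+ a - d)) × ((+ 2) ∣ (+ c′ - e)) ×
    ((ιℕ R 2 * Poly2.A F ≈ ιℕ R a) ×
     (ιℕ R 2 * Poly2.B F ≈ ιℕ R 2 * ιℤ R b) ×
     (ιℕ R 2 * Poly2.C F ≈ ιℕ R c′) ×
     (ιℕ R 2 * Poly2.D F ≈ ιℤ R d) ×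
     (ιℕ R 2 * Poly2.E F ≈ ιℤ R e) ×
     (Poly2.G F ≈ ιℕ R f)) ×
    (a ≡ 0 → c′ ≡ 0 → + 1 ≤ b)
lemma3 R fld (poly2 A B C D E G) deg g hg _ =
  a⁺ ∸ a⁻ , c⁺ ∸ c⁻ , g 0 0 , + b⁺ - + b⁻ , + d⁺ - + d⁻ , + e⁺ - + e⁻ ,
  second-difference-parity (g 0 0) (g 1 0) (g 2 0) a⁻≤a⁺ ,
  second-difference-parity (g 0 0) (g 0 1) (g 0 2) c⁻≤c⁺ ,
  ( +ι≈ι⇒≈ι∸ a⁻≤a⁺ x²-relation
  , *-congˡ (+ι≈ι⇒≈ιℤ b⁺ b⁻ xy-relation)
  , +ι≈ι⇒≈ι∸ c⁻≤c⁺ y²-relation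
  , +ι≈ι⇒≈ιℤ d⁺ d⁻ x-relation
  , +ι≈ι⇒≈ιℤ e⁺ e⁻ y-relation
  , constant-relation ) ,
  λ a≡0 c≡0 → m<n⇒+1≤+n-+m (b⁻<b⁺ deg a≡0 c≡0)
  where
  open CommutativeRing R using (*-congˡ)
  open RingEmbedding R
  open Coefficients fld A B C D E G g hg
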